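{- Let $a$ be a weak composition of length $n$ and let $k$ be the index of the last nonzero entry of $a$. Then the fundamental slide polynomial $\mathfrak{F}_a$ is quasisymmetric in $x_1,\dots,x_k$ if and only if $a$ is quasi-flat. Moreover, in this case $\mathfrak{F}_a=F_{\mathrm{flat}(a)}(x_1,\dots,x_k)$.
   Context: A weak composition of length $n$ is a sequence $a=(a_1,\dots,a_n)$ of nonnegative integers; $\mathrm{flat}(a)$ is the composition obtained by deleting zero entries; $a$ is quasi-flat if its nonzero entries occupy consecutive positions. A composition $\beta$ refines $\alpha$ if $\alpha$ is obtained from $\beta$ by summing consecutive blocks of parts. Dominance: $b\ge a$ if $b_1+\dots+b_i\ge a_1+\dots+a_i$ for all $i$. Fundamental slide polynomial: $\mathfrak{F}_a=\sum x_1^{b_1}\cdots x_n^{b_n}$ over weak compositions $b$ of length $n$ with $b\ge a$ and $\mathrm{flat}(b)$ refining $\mathrm{flat}(a)$. A polynomial in $x_1,\dots,x_k$ is quasisymmetric if for each composition $(\alpha_1,\dots,\alpha_\ell)$ the coefficient of $x_{i_1}^{\alpha_1}\cdots x_{i_\ell}^{\alpha_\ell}$ is independent of the choice $1\le i_1<\dots<i_\ell\le k$. For compositions, $M_\alpha(x_1,\dots,x_k)=\sum_{1\le i_1<\dots<i_\ell\le k}x_{i_1}^{\alpha_1}\cdots x_{i_\ell}^{\alpha_\ell}$ (zero if $\ell>k$) and $F_\alpha(x_1,\dots,x_k)=\sum_{\beta\text{ refines }\alpha}M_\beta(x_1,\dots,x_k)$. -}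

module Defs where

open import Data.Nat using (ℕ; zero; suc; _+_; _∸_; _<_; _≤_; _≡ᵇ_; _<ᵇ_; _≤ᵇ_; _≟_)
open import Data.Bool using (Bool; true; false; if_then_else_; _∧_; not)
open import Data.List using (List; []; _∷_; length; map; concatMap; upTo; filter; filterᵇ; _++_)
open import Data.Nat.ListAction using (sum)
open import Data.List.Relation.Unary.All using (All)
open import Data.List.Relation.Unary.Linked using (Linked)
open import Data.Vec using (Vec; []; _∷_; toList; tabulate; lookup)
open import Data.Vec.Properties using (≡-dec)
open import Data.Fin using (Fin; toℕ)
open import Data.Product using (_×_; _,_)
open import Relation.Binary.PropositionalEquality using (_≡_; _≢_)

-- Conventions: variables x_1,…,x_n are indexed 0-based (position i ↔ x_{i+1}).
-- A polynomial in x_1,…,x_n with ℕ coefficients is represented by its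
-- coefficient function on exponent vectors (monomials).
Poly : ℕ → Set
Poly n = Vec ℕ n → ℕ

WeakComp : ℕ → Set
WeakComp n = Vec ℕ n

IsComposition : List ℕ → Set
IsComposition α = All (λ x → 0 < x) α

flat : ∀ {n} → Vec ℕ n → List ℕ
flat a = filterᵇ (λ x → not (x ≡ᵇ 0)) (toList a)

QuasiFlat : ∀ {n} → WeakComp n → Set
QuasiFlat {n} a = (i j l : Fin n) → toℕ i ≤ toℕ j → toℕ j ≤ toℕ l →
  lookup a i ≢ 0 → lookup a l ≢ 0 → lookup a j ≢ 0

-- index (1-based) of the last nonzero entry; 0 if a has no nonzero entry
lastNZList : List ℕ → ℕ
lastNZList [] = 0
lastNZList (x ∷ xs) with lastNZList xs
... | zero = if x ≡ᵇ 0 then 0 else 1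
... | suc m = suc (suc m)

lastNZ : ∀ {n} → Vec ℕ n → ℕ
lastNZ a = lastNZList (toList a)

-- dominance b ≥ a: all partial sums of b are ≥ those of a
-- (dom sb sa b a carries the running partial sums sb of b and sa of a)
domAux : ∀ {n} → ℕ → ℕ → Vec ℕ n → Vec ℕ n → Bool
domAux sb sa [] [] = true
domAux sb sa (x ∷ xs) (y ∷ ys) = ((sa + y) ≤ᵇ (sb + x)) ∧ domAux (sb + x) (sa + y) xs ys

dominatesᵇ : ∀ {n} → Vec ℕ n → Vec ℕ n → Bool   -- dominatesᵇ b a = (b ≥ a)
dominatesᵇ b a = domAux 0 0 b a

-- refinesᵇ β α: α is obtained from β by summing consecutive blocks of parts
-- (greedy check; correct for compositions, i.e. positive parts)
refinesᵇ : List ℕ → List ℕ → Bool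
refinesᵇ [] [] = true
refinesᵇ [] (_ ∷ _) = false
refinesᵇ (_ ∷ _) [] = false
refinesᵇ (b ∷ bs) (a ∷ as) =
  if b <ᵇ a then refinesᵇ bs ((a ∸ b) ∷ as)
  else (if b ≡ᵇ a then refinesᵇ bs as else false)

slide : ∀ {n} → WeakComp n → Poly n
slide a b = if dominatesᵇ b a ∧ refinesᵇ (flat b) (flat a) then 1 else 0

-- monomial x_{i_1}^{α_1} ⋯ x_{i_ℓ}^{α_ℓ} (0-based indices i_j), as exponent vector
valAt : ℕ → List ℕ → List ℕ → ℕ
valAt j [] _ = 0
valAt j (_ ∷ _) [] = 0
valAt j (i ∷ is) (x ∷ xs) = if i ≡ᵇ j then x else valAt j is xs

place : ∀ {n} → List ℕ → List ℕ → Vec ℕ n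
place is α = tabulate (λ j → valAt (toℕ j) is α)

-- quasisymmetric in x_1,…,x_k: for each composition α of length ℓ, the coefficient
-- of x_{i_1}^{α_1}⋯x_{i_ℓ}^{α_ℓ} is the same for all 1 ≤ i_1 < ⋯ < i_ℓ ≤ k
-- (0-based: strictly increasing index lists with all entries < k)
IncSeq : ℕ → ℕ → List ℕ → Set
IncSeq ℓ k is = (length is ≡ ℓ) × Linked _<_ is × All (λ i → i < k) is

QuasiSymmetric : ∀ {n} → Poly n → ℕ → Set
QuasiSymmetric P k = (α : List ℕ) → IsComposition α →
  (is js : List ℕ) → IncSeq (length α) k is → IncSeq (length α) k js →
  P (place is α) ≡ P (place js α)

combs : ℕ → List ℕ → List (List ℕ)
combs zero _ = [] ∷ []
combs (suc l) [] = []
combs (suc l) (x ∷ xs) = map (x ∷_) (combs l xs) ++ combs (suc l) xs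

count : ∀ {n} → Vec ℕ n → List (Vec ℕ n) → ℕ
count b ms = length (filter (λ m → ≡-dec _≟_ m b) ms)

-- monomial quasisymmetric polynomial M_α(x_1,…,x_k), as a polynomial in x_1,…,x_n
-- (zero if ℓ > k since then there are no index sequences)
monoQS : ∀ {n} → List ℕ → ℕ → Poly n
monoQS α k b = count b (map (λ is → place is α) (combs (length α) (upTo k)))

-- all compositions of m with at most f parts
compsB : ℕ → ℕ → List (List ℕ)
compsB _ zero = [] ∷ []
compsB zero (suc m) = []
compsB (suc f) (suc m) = concatMap (λ p → map (suc p ∷_) (compsB f (m ∸ p))) (upTo (suc m))

compositions : ℕ → List (List ℕ)
compositions m = compsB m m

fundQS : ∀ {n} → List ℕ → ℕ → Poly n
fundQS α k b = sum (map (λ β → if refinesᵇ β α then monoQS β k b else 0) (compositions (sum α)))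

-- Write a quasi-flat a as 0^p α 0^q, so that k = p + ℓ(α). For b with flat(b) refining α the
-- dominance b ≥ a then just says that b vanishes after position k: the prefix sums of a are 0 up
-- to p and |α| = |b| from k on, and in between the first r blocks of α are covered by the parts
-- of b lying before position p + r, because the parts of b after it are at most ℓ(α) − r many.
-- So 𝔉_a is the sum of the monomials x^b supported in x_1,…,x_k with flat(b) refining α: this is
-- F_α(x_1,…,x_k), since each such x^b occurs exactly once in M_flat(b), and it is visibly
-- quasisymmetric. Conversely, if 𝔉_a is quasisymmetric then moving the ℓ nonzero exponents of
-- x^a to the positions k − ℓ + 1, …, k gives a monomial with coefficient 1, hence one dominating
-- a; so a vanishes before position k − ℓ + 1, and its ℓ nonzero entries fill the window up to k.

module Submission where

open import Defs
open import Data.Nat using (ℕ; zero; suc; _+_; _∸_; _<_; _≤_; _≡ᵇ_; _<ᵇ_; _≤ᵇ_; _≟_; _≤?_; z≤n; s≤s)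
open import Data.Nat.Properties
open import Data.Bool using (Bool; true; false; if_then_else_; _∧_; not; T)
open import Data.Bool.Properties using (∧-zeroʳ; ∧-identityʳ; T-≡; ⇔→≡)
open import Data.List using (List; []; _∷_; length; map; concatMap; upTo; applyUpTo; filter; filterᵇ; _++_; take; drop; replicate)
import Data.List.Properties as List
open import Data.Nat.ListAction using (sum)
open import Data.Nat.ListAction.Properties using (sum-++)
open import Data.List.Relation.Unary.All as All using (All; []; _∷_)
open import Data.List.Relation.Unary.All.Properties using (++⁺; map⁺; concat⁺; applyUpTo⁺₂)
open import Data.List.Relation.Unary.Linked as Linked using (Linked; [-]) renaming (_∷_ to _∷ᴸ_; [] to []ᴸ)
open import Data.Vec using (Vec; toList; tabulate)
import Data.Vec as Vec
import Data.Vec.Properties as Vec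
open import Data.Fin using (Fin; toℕ; fromℕ<)
import Data.Fin as Fin
open import Data.Fin.Properties using (toℕ-fromℕ<)
open import Data.Product using (_×_; _,_; proj₁; proj₂; map₁; ∃-syntax)
open import Data.Sum using (_⊎_; inj₁; inj₂)
open import Data.Empty using (⊥-elim)
open import Function using (_∘_; id)
open import Function.Bundles using (_⇔_; mk⇔; Equivalence)
open import Relation.Nullary using (¬_; yes; no)
open import Relation.Unary using (Pred; Decidable)
open import Relation.Binary.PropositionalEquality
open import Level using (0ℓ)

-- Exponent lists

𝟙 : Bool → ℕ
𝟙 b = if b then 1 else 0

allZeroᵇ : List ℕ → Bool
allZeroᵇ [] = true
allZeroᵇ (x ∷ xs) = (x ≡ᵇ 0) ∧ allZeroᵇ xs

zeros : ℕ → List ℕ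
zeros p = replicate p 0

flatList : List ℕ → List ℕ
flatList = filterᵇ (λ x → not (x ≡ᵇ 0))

nth : List ℕ → ℕ → ℕ
nth [] _ = 0
nth (x ∷ xs) zero = x
nth (x ∷ xs) (suc t) = nth xs t

interval : ℕ → ℕ → List ℕ
interval m zero = []
interval m (suc d) = m ∷ interval (suc m) d

≡ᵇ-refl : ∀ m → (m ≡ᵇ m) ≡ true
≡ᵇ-refl zero = refl
≡ᵇ-refl (suc m) = ≡ᵇ-refl m

≢⇒≡ᵇ-false : ∀ {i j} → i ≢ j → (i ≡ᵇ j) ≡ false
≢⇒≡ᵇ-false {zero} {zero} i≢j = ⊥-elim (i≢j refl)
≢⇒≡ᵇ-false {zero} {suc j} _ = refl
≢⇒≡ᵇ-false {suc i} {zero} _ = refl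
≢⇒≡ᵇ-false {suc i} {suc j} i≢j = ≢⇒≡ᵇ-false (i≢j ∘ cong suc)

<ᵇ-irrefl : ∀ m → (m <ᵇ m) ≡ false
<ᵇ-irrefl zero = refl
<ᵇ-irrefl (suc m) = <ᵇ-irrefl m

false≢true : false ≢ true
false≢true ()

allZero⇒sum≡0 : ∀ c → allZeroᵇ c ≡ true → sum c ≡ 0
allZero⇒sum≡0 [] _ = refl
allZero⇒sum≡0 (zero ∷ c) e = allZero⇒sum≡0 c e

sum≡0⇒allZero : ∀ c → sum c ≡ 0 → allZeroᵇ c ≡ true
sum≡0⇒allZero [] _ = refl
sum≡0⇒allZero (zero ∷ c) e = sum≡0⇒allZero c e

allZero⇒flat≡[] : ∀ c → allZeroᵇ c ≡ true → flatList c ≡ []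
allZero⇒flat≡[] [] _ = refl
allZero⇒flat≡[] (zero ∷ c) e = allZero⇒flat≡[] c e

flat≡[]⇒allZero : ∀ c → flatList c ≡ [] → allZeroᵇ c ≡ true
flat≡[]⇒allZero [] _ = refl
flat≡[]⇒allZero (zero ∷ c) e = flat≡[]⇒allZero c e

allZero⇒≡zeros : ∀ c → allZeroᵇ c ≡ true → c ≡ zeros (length c)
allZero⇒≡zeros [] _ = refl
allZero⇒≡zeros (zero ∷ c) e = cong (0 ∷_) (allZero⇒≡zeros c e)

allZero-zeros : ∀ p → allZeroᵇ (zeros p) ≡ true
allZero-zeros zero = refl
allZero-zeros (suc p) = allZero-zeros p

allZero-drop : ∀ d c → allZeroᵇ c ≡ true → allZeroᵇ (drop d c) ≡ true
allZero-drop zero c e = e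
allZero-drop (suc d) [] e = refl
allZero-drop (suc d) (zero ∷ c) e = allZero-drop d c e

allZero-nth : ∀ c t → allZeroᵇ c ≡ true → nth c t ≡ 0
allZero-nth [] t _ = refl
allZero-nth (zero ∷ c) zero _ = refl
allZero-nth (zero ∷ c) (suc t) e = allZero-nth c t e

allZero-false⇒nth≢0 : ∀ c → allZeroᵇ c ≡ false → ∃[ u ] nth c u ≢ 0
allZero-false⇒nth≢0 (zero ∷ c) e with allZero-false⇒nth≢0 c e
... | u , h = suc u , h
allZero-false⇒nth≢0 (suc x ∷ c) e = 0 , λ ()

flat-isComposition : ∀ c → IsComposition (flatList c)
flat-isComposition [] = []
flat-isComposition (zero ∷ c) = flat-isComposition c
flat-isComposition (suc y ∷ c) = s≤s z≤n ∷ flat-isComposition c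

flat-++ : ∀ xs ys → flatList (xs ++ ys) ≡ flatList xs ++ flatList ys
flat-++ [] ys = refl
flat-++ (zero ∷ xs) ys = flat-++ xs ys
flat-++ (suc x ∷ xs) ys = cong (suc x ∷_) (flat-++ xs ys)

sum-flat : ∀ c → sum (flatList c) ≡ sum c
sum-flat [] = refl
sum-flat (zero ∷ c) = sum-flat c
sum-flat (suc x ∷ c) = cong (suc x +_) (sum-flat c)

length-flat≤ : ∀ c → length (flatList c) ≤ length c
length-flat≤ [] = z≤n
length-flat≤ (zero ∷ c) = m≤n⇒m≤1+n (length-flat≤ c)
length-flat≤ (suc x ∷ c) = s≤s (length-flat≤ c)

length-flat< : ∀ c t → t < length c → nth c t ≡ 0 → length (flatList c) < length c
length-flat< (zero ∷ c) zero _ _ = s≤s (length-flat≤ c)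
length-flat< (zero ∷ c) (suc t) (s≤s t<) e = m<n⇒m<1+n (length-flat< c t t< e)
length-flat< (suc x ∷ c) (suc t) (s≤s t<) e = s≤s (length-flat< c t t< e)

sum-zeros : ∀ p → sum (zeros p) ≡ 0
sum-zeros p = allZero⇒sum≡0 (zeros p) (allZero-zeros p)

flat-zeros : ∀ p → flatList (zeros p) ≡ []
flat-zeros p = allZero⇒flat≡[] (zeros p) (allZero-zeros p)

flat-composition : ∀ α → IsComposition α → flatList α ≡ α
flat-composition [] _ = refl
flat-composition (suc x ∷ α) (_ ∷ α⁺) = cong (suc x ∷_) (flat-composition α α⁺)

length-flat-split : ∀ i xs → length (flatList xs) ≡ length (flatList (take i xs)) + length (flatList (drop i xs))
length-flat-split i xs = begin
  length (flatList xs)                                    ≡⟨ cong (length ∘ flatList) (List.take++drop≡id i xs) ⟨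
  length (flatList (take i xs ++ drop i xs))               ≡⟨ cong length (flat-++ (take i xs) (drop i xs)) ⟩
  length (flatList (take i xs) ++ flatList (drop i xs))    ≡⟨ List.length-++ (flatList (take i xs)) ⟩
  length (flatList (take i xs)) + length (flatList (drop i xs)) ∎
  where open ≡-Reasoning

length-take≤ : ∀ u (xs : List ℕ) → length (take u xs) ≤ u
length-take≤ u xs = ≤-trans (≤-reflexive (List.length-take u xs)) (m⊓n≤m u _)

length-flat-allZero-drop : ∀ d xs → allZeroᵇ (drop d xs) ≡ true → length (flatList xs) ≤ d
length-flat-allZero-drop d xs z = begin
  length (flatList xs)                                          ≡⟨ length-flat-split d xs ⟩
  length (flatList (take d xs)) + length (flatList (drop d xs)) ≡⟨ cong (λ t → length (flatList (take d xs)) + length t) (allZero⇒flat≡[] (drop d xs) z) ⟩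
  length (flatList (take d xs)) + 0                             ≤⟨ +-monoˡ-≤ 0 (length-flat≤ (take d xs)) ⟩
  length (take d xs) + 0                                        ≤⟨ +-monoˡ-≤ 0 (length-take≤ d xs) ⟩
  d + 0                                                         ≡⟨ +-identityʳ d ⟩
  d ∎
  where open ≤-Reasoning

nth-drop : ∀ d xs t → nth (drop d xs) t ≡ nth xs (d + t)
nth-drop zero xs t = refl
nth-drop (suc d) [] t = refl
nth-drop (suc d) (x ∷ xs) t = nth-drop d xs t

nth-take : ∀ d xs t → t < d → nth (take d xs) t ≡ nth xs t
nth-take (suc d) [] t _ = refl
nth-take (suc d) (x ∷ xs) zero _ = refl
nth-take (suc d) (x ∷ xs) (suc t) (s≤s t<d) = nth-take d xs t t<d

nth-++ : ∀ xs ys t → nth (xs ++ ys) (length xs + t) ≡ nth ys t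
nth-++ [] ys t = refl
nth-++ (x ∷ xs) ys t = nth-++ xs ys t

nth-zeros-++ : ∀ p ys t → nth (zeros p ++ ys) (p + t) ≡ nth ys t
nth-zeros-++ zero ys t = refl
nth-zeros-++ (suc p) ys t = nth-zeros-++ p ys t

nth≢0⇒<length : ∀ xs t → nth xs t ≢ 0 → t < length xs
nth≢0⇒<length [] t ≢0 = ⊥-elim (≢0 refl)
nth≢0⇒<length (x ∷ xs) zero _ = s≤s z≤n
nth≢0⇒<length (x ∷ xs) (suc t) ≢0 = s≤s (nth≢0⇒<length xs t ≢0)

nth-toList : ∀ {n} (a : Vec ℕ n) (i : Fin n) → Vec.lookup a i ≡ nth (toList a) (toℕ i)
nth-toList (x Vec.∷ a) Fin.zero = refl
nth-toList (x Vec.∷ a) (Fin.suc i) = nth-toList a i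

toList-injective : ∀ {n} (u v : Vec ℕ n) → toList u ≡ toList v → u ≡ v
toList-injective Vec.[] Vec.[] _ = refl
toList-injective (x Vec.∷ u) (y Vec.∷ v) e =
  cong₂ Vec._∷_ (List.∷-injectiveˡ e) (toList-injective u v (List.∷-injectiveʳ e))

sum-take-mono : ∀ i j xs → i ≤ j → sum (take i xs) ≤ sum (take j xs)
sum-take-mono zero j xs _ = z≤n
sum-take-mono (suc i) (suc j) [] _ = z≤n
sum-take-mono (suc i) (suc j) (x ∷ xs) (s≤s i≤j) = +-monoʳ-≤ x (sum-take-mono i j xs i≤j)

sum-take≤sum : ∀ i xs → sum (take i xs) ≤ sum xs
sum-take≤sum zero xs = z≤n
sum-take≤sum (suc i) [] = z≤n
sum-take≤sum (suc i) (x ∷ xs) = +-monoʳ-≤ x (sum-take≤sum i xs)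

sum-take-++ʳ : ∀ xs r ys → sum (take (length xs + r) (xs ++ ys)) ≡ sum xs + sum (take r ys)
sum-take-++ʳ [] r ys = refl
sum-take-++ʳ (x ∷ xs) r ys = trans (cong (x +_) (sum-take-++ʳ xs r ys)) (sym (+-assoc x _ _))

sum-take-++ˡ : ∀ r xs ys → r ≤ length xs → sum (take r (xs ++ ys)) ≡ sum (take r xs)
sum-take-++ˡ zero xs ys _ = refl
sum-take-++ˡ (suc r) (x ∷ xs) ys (s≤s r≤) = cong (x +_) (sum-take-++ˡ r xs ys r≤)

sum-take+sum-drop : ∀ i xs → sum xs ≡ sum (take i xs) + sum (drop i xs)
sum-take+sum-drop i xs = trans (cong sum (sym (List.take++drop≡id i xs))) (sum-++ (take i xs) (drop i xs))

sum-take-flat : ∀ i c → sum (take i c) ≡ sum (take (length (flatList (take i c))) (flatList c))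
sum-take-flat zero c = refl
sum-take-flat (suc i) [] = refl
sum-take-flat (suc i) (zero ∷ c) = sum-take-flat i c
sum-take-flat (suc i) (suc y ∷ c) = cong (suc y +_) (sum-take-flat i c)

All-≤-weaken : ∀ {m} {is : List ℕ} → All (suc m ≤_) is → All (m ≤_) is
All-≤-weaken = All.map (≤-trans (n≤1+n _))

All-<-cast : ∀ {a b} {is : List ℕ} → a ≡ b → All (_< a) is → All (_< b) is
All-<-cast a≡b = All.map (λ {x} → subst (x <_) a≡b)

Linked⇒All-head : ∀ {i is} → Linked _<_ (i ∷ is) → All (i <_) is
Linked⇒All-head [-] = []
Linked⇒All-head (i<j ∷ᴸ rest) = i<j ∷ All.map (<-trans i<j) (Linked⇒All-head rest)

All⇒Linked : ∀ {m ys} → All (m <_) ys → Linked _<_ ys → Linked _<_ (m ∷ ys)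
All⇒Linked [] _ = [-]
All⇒Linked (m<y ∷ _) L = m<y ∷ᴸ L

interval-≥ : ∀ m d → All (m ≤_) (interval m d)
interval-≥ m zero = []
interval-≥ m (suc d) = ≤-refl ∷ All-≤-weaken (interval-≥ (suc m) d)

interval-< : ∀ m d → All (_< m + d) (interval m d)
interval-< m zero = []
interval-< m (suc d) = m<m+n m (s≤s z≤n) ∷ All-<-cast (sym (+-suc m d)) (interval-< (suc m) d)

interval-Linked : ∀ m d → Linked _<_ (interval m d)
interval-Linked m zero = []ᴸ
interval-Linked m (suc d) = All⇒Linked (interval-≥ (suc m) d) (interval-Linked (suc m) d)

length-interval : ∀ m d → length (interval m d) ≡ d
length-interval m zero = refl
length-interval m (suc d) = cong suc (length-interval (suc m) d)

upTo≡interval : ∀ k → upTo k ≡ interval 0 k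
upTo≡interval k = applyUpTo-shift id 0 k (λ _ → refl)
  where
  applyUpTo-shift : ∀ f m d → (∀ i → f i ≡ m + i) → applyUpTo f d ≡ interval m d
  applyUpTo-shift f m zero _ = refl
  applyUpTo-shift f m (suc d) f≗m+ = cong₂ _∷_ (trans (f≗m+ 0) (+-identityʳ m))
    (applyUpTo-shift (f ∘ suc) (suc m) d (λ i → trans (f≗m+ (suc i)) (+-suc m i)))

combs-≥ : ∀ l m d → All (All (m ≤_)) (combs l (interval m d))
combs-≥ zero m d = [] ∷ []
combs-≥ (suc l) m zero = []
combs-≥ (suc l) m (suc d) =
  ++⁺ (map⁺ (All.map (λ is≥ → ≤-refl ∷ All-≤-weaken is≥) (combs-≥ l (suc m) d)))
      (All.map All-≤-weaken (combs-≥ (suc l) (suc m) d))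

-- Counting the monomials of M_β

-- Exponents at positions m, …, m + N - 1 of the monomial x_{is}^β.
spread : ℕ → ℕ → List ℕ → List ℕ → List ℕ
spread m zero is β = []
spread m (suc N) is β = valAt m is β ∷ spread (suc m) N is β

toList-place : ∀ {n} is β → toList (place {n} is β) ≡ spread 0 n is β
toList-place {n} is β = shifted n 0
  where
  shifted : ∀ n m → toList (tabulate {n = n} (λ j → valAt (m + toℕ j) is β)) ≡ spread m n is β
  shifted zero m = refl
  shifted (suc n) m = cong₂ _∷_ (cong (λ t → valAt t is β) (+-identityʳ m))
    (trans (cong toList (Vec.tabulate-cong (λ j → cong (λ t → valAt t is β) (+-suc m (toℕ j)))))
           (shifted n (suc m)))

valAt-here : ∀ j is x β → valAt j (j ∷ is) (x ∷ β) ≡ x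
valAt-here j is x β rewrite ≡ᵇ-refl j = refl

valAt-there : ∀ {i j} is x β → i ≢ j → valAt j (i ∷ is) (x ∷ β) ≡ valAt j is β
valAt-there is x β i≢j rewrite ≢⇒≡ᵇ-false i≢j = refl

valAt-absent : ∀ j is β → All (_≢ j) is → valAt j is β ≡ 0
valAt-absent j [] β _ = refl
valAt-absent j (i ∷ is) [] _ = refl
valAt-absent j (i ∷ is) (x ∷ β) (i≢j ∷ is≢j) = trans (valAt-there is x β i≢j) (valAt-absent j is β is≢j)

spread-skip : ∀ m N i is x β → i < m → spread m N (i ∷ is) (x ∷ β) ≡ spread m N is β
spread-skip m zero i is x β _ = refl
spread-skip m (suc N) i is x β i<m =
  cong₂ _∷_ (valAt-there is x β (<⇒≢ i<m)) (spread-skip (suc m) N i is x β (m<n⇒m<1+n i<m))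

spread-here : ∀ m N is x β → spread m (suc N) (m ∷ is) (x ∷ β) ≡ x ∷ spread (suc m) N is β
spread-here m N is x β = cong₂ _∷_ (valAt-here m is x β) (spread-skip (suc m) N m is x β ≤-refl)

spread-gap : ∀ m N is β → All (suc m ≤_) is → spread m (suc N) is β ≡ 0 ∷ spread (suc m) N is β
spread-gap m N is β is> = cong (_∷ spread (suc m) N is β) (valAt-absent m is β (All.map >⇒≢ is>))

spread-[] : ∀ m c → spread m (length c) [] [] ≡ c → allZeroᵇ c ≡ true
spread-[] m [] _ = refl
spread-[] m (zero ∷ c) e = spread-[] (suc m) c (List.∷-injectiveʳ e)

allZero⇒spread-[] : ∀ m c → allZeroᵇ c ≡ true → spread m (length c) [] [] ≡ c
allZero⇒spread-[] m [] _ = refl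
allZero⇒spread-[] m (zero ∷ c) e = cong (0 ∷_) (allZero⇒spread-[] (suc m) c e)

spread-allZero : ∀ m N is β → All (_< m) is → allZeroᵇ (spread m N is β) ≡ true
spread-allZero m zero is β _ = refl
spread-allZero m (suc N) is β is< rewrite valAt-absent m is β (All.map <⇒≢ is<) =
  spread-allZero (suc m) N is β (All.map m<n⇒m<1+n is<)

drop-spread : ∀ d m N is β → drop d (spread m N is β) ≡ spread (m + d) (N ∸ d) is β
drop-spread zero m N is β = cong (λ t → spread t N is β) (sym (+-identityʳ m))
drop-spread (suc d) m zero is β = refl
drop-spread (suc d) m (suc N) is β =
  trans (drop-spread d (suc m) N is β) (cong (λ t → spread t (N ∸ d) is β) (sym (+-suc m d)))

sum-take-spread : ∀ i m N is β → All (m + i ≤_) is → sum (take i (spread m N is β)) ≡ 0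
sum-take-spread zero m N is β _ = refl
sum-take-spread (suc i) m zero is β _ = refl
sum-take-spread (suc i) m (suc N) is β is≥
  rewrite valAt-absent m is β (All.map (λ q → >⇒≢ (<-≤-trans (m<m+n m (s≤s z≤n)) q)) is≥)
  = sum-take-spread i (suc m) N is β (All.map (λ {x} → subst (_≤ x) (+-suc m i)) is≥)

flat-spread : ∀ m N is β → Linked _<_ is → All (m ≤_) is → All (_< m + N) is →
  length is ≡ length β → IsComposition β → flatList (spread m N is β) ≡ β
flat-spread m zero [] [] _ _ _ _ _ = refl
flat-spread m zero (i ∷ is) β _ (m≤i ∷ _) (i<m+0 ∷ _) _ _ =
  ⊥-elim (<-irrefl refl (≤-<-trans m≤i (subst (i <_) (+-identityʳ m) i<m+0)))
flat-spread m (suc N) [] [] L _ _ _ _ = flat-spread (suc m) N [] [] L [] [] refl []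
flat-spread m (suc N) (i ∷ is) (suc x ∷ β) L (m≤i ∷ _) (i< ∷ is<) len (_ ∷ β⁺) with i ≟ m
... | yes refl = trans (cong flatList (spread-here m N is (suc x) β))
        (cong (suc x ∷_) (flat-spread (suc m) N is β (Linked.tail L) (Linked⇒All-head L)
           (All-<-cast (+-suc m N) is<) (suc-injective len) β⁺))
... | no i≢m = trans (cong flatList (spread-gap m N (i ∷ is) (suc x ∷ β) is>m))
        (flat-spread (suc m) N (i ∷ is) (suc x ∷ β) L is>m
          (All-<-cast (+-suc m N) (i< ∷ is<)) len (s≤s z≤n ∷ β⁺))
  where
  m<i : m < i
  m<i = ≤∧≢⇒< m≤i (i≢m ∘ sym)
  is>m : All (suc m ≤_) (i ∷ is)
  is>m = m<i ∷ All.map (<-trans m<i) (Linked⇒All-head L)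

positions : ℕ → List ℕ → List ℕ
positions m [] = []
positions m (zero ∷ c) = positions (suc m) c
positions m (suc x ∷ c) = m ∷ positions (suc m) c

length-positions : ∀ m c → length (positions m c) ≡ length (flatList c)
length-positions m [] = refl
length-positions m (zero ∷ c) = length-positions (suc m) c
length-positions m (suc x ∷ c) = cong suc (length-positions (suc m) c)

positions-≥ : ∀ m c → All (m ≤_) (positions m c)
positions-≥ m [] = []
positions-≥ m (zero ∷ c) = All-≤-weaken (positions-≥ (suc m) c)
positions-≥ m (suc x ∷ c) = ≤-refl ∷ All-≤-weaken (positions-≥ (suc m) c)

positions-Linked : ∀ m c → Linked _<_ (positions m c)
positions-Linked m [] = []ᴸ
positions-Linked m (zero ∷ c) = positions-Linked (suc m) c
positions-Linked m (suc x ∷ c) = All⇒Linked (positions-≥ (suc m) c) (positions-Linked (suc m) c)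

positions-< : ∀ m d c → allZeroᵇ (drop d c) ≡ true → All (_< m + d) (positions m c)
positions-< m d [] _ = []
positions-< m zero c z = subst (All _) (sym (positions-allZero m c z)) []
  where
  positions-allZero : ∀ m c → allZeroᵇ c ≡ true → positions m c ≡ []
  positions-allZero m [] _ = refl
  positions-allZero m (zero ∷ c) z = positions-allZero (suc m) c z
positions-< m (suc d) (zero ∷ c) z = All-<-cast (sym (+-suc m d)) (positions-< (suc m) d c z)
positions-< m (suc d) (suc x ∷ c) z = m<m+n m (s≤s z≤n) ∷ All-<-cast (sym (+-suc m d)) (positions-< (suc m) d c z)

spread-positions : ∀ m c → spread m (length c) (positions m c) (flatList c) ≡ c
spread-positions m [] = refl
spread-positions m (zero ∷ c) =
  trans (spread-gap m (length c) (positions (suc m) c) (flatList c) (positions-≥ (suc m) c))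
        (cong (0 ∷_) (spread-positions (suc m) c))
spread-positions m (suc x ∷ c) =
  trans (spread-here m (length c) (positions (suc m) c) (suc x) (flatList c))
        (cong (suc x ∷_) (spread-positions (suc m) c))

module _ {A : Set} where

  count-++ : ∀ {P : Pred A 0ℓ} (P? : Decidable P) xs ys →
    length (filter P? (xs ++ ys)) ≡ length (filter P? xs) + length (filter P? ys)
  count-++ P? xs ys = trans (cong length (List.filter-++ P? xs ys)) (List.length-++ (filter P? xs))

  count-map : ∀ {B : Set} {P : Pred B 0ℓ} (P? : Decidable P) (f : A → B) xs →
    length (filter P? (map f xs)) ≡ length (filter (P? ∘ f) xs)
  count-map P? f [] = refl
  count-map P? f (x ∷ xs) with P? (f x)
  ... | yes _ = cong suc (count-map P? f xs)
  ... | no _ = count-map P? f xs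

  count-cong : ∀ {P Q R : Pred A 0ℓ} (P? : Decidable P) (Q? : Decidable Q) xs → All R xs →
    (∀ {x} → R x → P x → Q x) → (∀ {x} → R x → Q x → P x) →
    length (filter P? xs) ≡ length (filter Q? xs)
  count-cong P? Q? [] _ _ _ = refl
  count-cong P? Q? (x ∷ xs) (r ∷ rs) P⇒Q Q⇒P with P? x | Q? x
  ... | yes _ | yes _ = cong suc (count-cong P? Q? xs rs P⇒Q Q⇒P)
  ... | no _ | no _ = count-cong P? Q? xs rs P⇒Q Q⇒P
  ... | yes p | no ¬q = ⊥-elim (¬q (P⇒Q r p))
  ... | no ¬p | yes q = ⊥-elim (¬p (Q⇒P r q))

  count-none : ∀ {P R : Pred A 0ℓ} (P? : Decidable P) xs → All R xs →
    (∀ {x} → R x → ¬ P x) → length (filter P? xs) ≡ 0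
  count-none P? xs rs R⇒¬P = cong length (List.filter-none P? (All.map R⇒¬P rs))

-- c is β with zeros inserted, all entries of β lying in the first d positions.
IsPaddingᵇ : ℕ → List ℕ → List ℕ → Bool
IsPaddingᵇ d [] c = allZeroᵇ c
IsPaddingᵇ zero (_ ∷ _) c = false
IsPaddingᵇ (suc d) (_ ∷ _) [] = false
IsPaddingᵇ (suc d) β (zero ∷ c) = IsPaddingᵇ d β c
IsPaddingᵇ (suc d) (x ∷ β) (suc y ∷ c) = (suc y ≡ᵇ x) ∧ IsPaddingᵇ d β c

spread≟ : (m : ℕ) (β c : List ℕ) → Decidable (λ is → spread m (length c) is β ≡ c)
spread≟ m β c is = List.≡-dec _≟_ (spread m (length c) is β) c

count-spread : ∀ β m d c → IsComposition β → d ≤ length c →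
  length (filter (spread≟ m β c) (combs (length β) (interval m d))) ≡ 𝟙 (IsPaddingᵇ d β c)
count-spread [] m d c _ _ with spread≟ m [] c []
... | yes e rewrite spread-[] m c e = refl
... | no ¬e with allZeroᵇ c in z
...   | true = ⊥-elim (¬e (allZero⇒spread-[] m c z))
...   | false = refl
count-spread (x ∷ β) m zero c _ _ = refl
count-spread (suc x ∷ β) m (suc d) (y ∷ c) (x>0 ∷ β⁺) (s≤s d≤) =
  begin
    length (filter P? (map (m ∷_) L₁ ++ L₂))
  ≡⟨ count-++ P? (map (m ∷_) L₁) L₂ ⟩
    length (filter P? (map (m ∷_) L₁)) + length (filter P? L₂)
  ≡⟨ cong (_+ length (filter P? L₂)) (count-map P? (m ∷_) L₁) ⟩
    length (filter (P? ∘ (m ∷_)) L₁) + length (filter P? L₂)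
  ≡⟨ split y ⟩
    𝟙 (IsPaddingᵇ (suc d) (suc x ∷ β) (y ∷ c))
  ∎
  where
  open ≡-Reasoning
  P? = spread≟ m (suc x ∷ β) (y ∷ c)
  L₁ = combs (length β) (interval (suc m) d)
  L₂ = combs (suc (length β)) (interval (suc m) d)
  L₁≥ = combs-≥ (length β) (suc m) d
  L₂≥ = combs-≥ (suc (length β)) (suc m) d
  N = length c
  here : ∀ is → spread m (suc N) (m ∷ is) (suc x ∷ β) ≡ suc x ∷ spread (suc m) N is β
  here is = spread-here m N is (suc x) β
  gap : ∀ {is} → All (suc m ≤_) is → spread m (suc N) is (suc x ∷ β) ≡ 0 ∷ spread (suc m) N is (suc x ∷ β)
  gap {is} = spread-gap m N is (suc x ∷ β)
  -- Index sequences through m put the first part of β at the head of c; the others put 0 there.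
  split : ∀ y → length (filter (spread≟ m (suc x ∷ β) (y ∷ c) ∘ (m ∷_)) L₁) + length (filter (spread≟ m (suc x ∷ β) (y ∷ c)) L₂)
              ≡ 𝟙 (IsPaddingᵇ (suc d) (suc x ∷ β) (y ∷ c))
  split zero = cong₂ _+_
    (count-none _ L₁ L₁≥ (λ {is} _ e → 0≢1+n (sym (List.∷-injectiveˡ (trans (sym (here is)) e)))))
    (trans (count-cong _ (spread≟ (suc m) (suc x ∷ β) c) L₂ L₂≥
              (λ is≥ e → List.∷-injectiveʳ (trans (sym (gap is≥)) e))
              (λ is≥ e → trans (gap is≥) (cong (0 ∷_) e)))
           (count-spread (suc x ∷ β) (suc m) d c (x>0 ∷ β⁺) d≤))
  split (suc y) with y ≟ x
  ... | yes refl rewrite ≡ᵇ-refl x = trans (cong₂ _+_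
    (trans (count-cong _ (spread≟ (suc m) β c) L₁ L₁≥
              (λ {is} _ e → List.∷-injectiveʳ (trans (sym (here is)) e))
              (λ {is} _ e → trans (here is) (cong (suc x ∷_) e)))
           (count-spread β (suc m) d c β⁺ d≤))
    (count-none _ L₂ L₂≥ (λ is≥ e → 0≢1+n (List.∷-injectiveˡ (trans (sym (gap is≥)) e)))))
    (+-identityʳ _)
  ... | no y≢x rewrite ≢⇒≡ᵇ-false y≢x = cong₂ _+_
    (count-none _ L₁ L₁≥ (λ {is} _ e → y≢x (sym (suc-injective (List.∷-injectiveˡ (trans (sym (here is)) e))))))
    (count-none _ L₂ L₂≥ (λ is≥ e → 0≢1+n (List.∷-injectiveˡ (trans (sym (gap is≥)) e))))

IsPadding-sound : ∀ d β c → IsComposition β → IsPaddingᵇ d β c ≡ true →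
  flatList c ≡ β × allZeroᵇ (drop d c) ≡ true
IsPadding-sound d [] c _ e = allZero⇒flat≡[] c e , allZero-drop d c e
IsPadding-sound (suc d) (x ∷ β) (zero ∷ c) β⁺ e = IsPadding-sound d (x ∷ β) c β⁺ e
IsPadding-sound (suc d) (suc x ∷ β) (suc y ∷ c) (_ ∷ β⁺) e with y ≟ x
... | yes refl rewrite ≡ᵇ-refl y =
  map₁ (cong (suc y ∷_)) (IsPadding-sound d β c β⁺ e)
... | no y≢x rewrite ≢⇒≡ᵇ-false y≢x = ⊥-elim (false≢true e)

IsPadding-complete : ∀ d c → allZeroᵇ (drop d c) ≡ true → IsPaddingᵇ d (flatList c) c ≡ true
IsPadding-complete d [] _ = refl
IsPadding-complete zero c z = subst (λ β → IsPaddingᵇ 0 β c ≡ true) (sym (allZero⇒flat≡[] c z)) z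
IsPadding-complete (suc d) (zero ∷ c) z with flatList c in eq
... | [] = flat≡[]⇒allZero c eq
... | x ∷ β = subst (λ β′ → IsPaddingᵇ d β′ c ≡ true) eq (IsPadding-complete d c z)
IsPadding-complete (suc d) (suc y ∷ c) z rewrite ≡ᵇ-refl y = IsPadding-complete d c z

monoQS-padding : ∀ {n} β k (b : Vec ℕ n) → IsComposition β → k ≤ n →
  monoQS β k b ≡ 𝟙 (IsPaddingᵇ k β (toList b))
monoQS-padding {n} β k b β⁺ k≤n = begin
    length (filter (λ v → Vec.≡-dec _≟_ v b) (map (λ is → place is β) (combs (length β) (upTo k))))
  ≡⟨ count-map (λ v → Vec.≡-dec _≟_ v b) (λ is → place is β) (combs (length β) (upTo k)) ⟩
    length (filter (λ is → Vec.≡-dec _≟_ (place is β) b) (combs (length β) (upTo k)))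
  ≡⟨ cong (λ L → length (filter (λ is → Vec.≡-dec _≟_ (place is β) b) (combs (length β) L))) (upTo≡interval k) ⟩
    length (filter (λ is → Vec.≡-dec _≟_ (place is β) b) (combs (length β) (interval 0 k)))
  ≡⟨ count-cong _ (spread≟ 0 β bs) _ (combs-≥ (length β) 0 k)
       (λ {is} _ e → trans (sym (spread-length is)) (trans (sym (toList-place is β)) (cong toList e)))
       (λ {is} _ e → toList-injective (place is β) b (trans (toList-place is β) (trans (spread-length is) e))) ⟩
    length (filter (spread≟ 0 β bs) (combs (length β) (interval 0 k)))
  ≡⟨ count-spread β 0 k bs β⁺ (subst (k ≤_) (sym (Vec.length-toList b)) k≤n) ⟩
    𝟙 (IsPaddingᵇ k β bs)
  ∎
  where
  open ≡-Reasoning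
  bs = toList b
  spread-length : ∀ is → spread 0 n is β ≡ spread 0 (length bs) is β
  spread-length is = cong (λ N → spread 0 N is β) (sym (Vec.length-toList b))

monoQS-flat : ∀ {n} k (b : Vec ℕ n) → k ≤ n →
  monoQS (flatList (toList b)) k b ≡ 𝟙 (allZeroᵇ (drop k (toList b)))
monoQS-flat k b k≤n = trans (monoQS-padding (flatList bs) k b (flat-isComposition bs) k≤n)
  (cong 𝟙 (⇔→≡ (mk⇔ (proj₂ ∘ IsPadding-sound k (flatList bs) bs (flat-isComposition bs))
                     (IsPadding-complete k bs))))
  where bs = toList b

monoQS-≢flat : ∀ {n} β k (b : Vec ℕ n) → IsComposition β → k ≤ n → β ≢ flatList (toList b) →
  monoQS β k b ≡ 0
monoQS-≢flat β k b β⁺ k≤n β≢ with IsPaddingᵇ k β (toList b) in e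
... | true = ⊥-elim (β≢ (sym (proj₁ (IsPadding-sound k β (toList b) β⁺ e))))
... | false = trans (monoQS-padding β k b β⁺ k≤n) (cong 𝟙 e)

-- Fundamental quasisymmetric polynomials

sum-map-≡0 : ∀ {A : Set} (g : A → ℕ) {xs} → All (λ x → g x ≡ 0) xs → sum (map g xs) ≡ 0
sum-map-≡0 g [] = refl
sum-map-≡0 g (gx≡0 ∷ gxs≡0) = cong₂ _+_ gx≡0 (sum-map-≡0 g gxs≡0)

sum-map-concatMap : ∀ {A B : Set} (g : B → ℕ) (h : A → List B) xs →
  sum (map g (concatMap h xs)) ≡ sum (map (λ x → sum (map g (h x))) xs)
sum-map-concatMap g h [] = refl
sum-map-concatMap g h (x ∷ xs) = begin
  sum (map g (h x ++ concatMap h xs))                ≡⟨ cong sum (List.map-++ g (h x) (concatMap h xs)) ⟩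
  sum (map g (h x) ++ map g (concatMap h xs))        ≡⟨ sum-++ (map g (h x)) (map g (concatMap h xs)) ⟩
  sum (map g (h x)) + sum (map g (concatMap h xs))   ≡⟨ cong (sum (map g (h x)) +_) (sum-map-concatMap g h xs) ⟩
  sum (map g (h x)) + sum (map (λ x → sum (map g (h x))) xs) ∎
  where open ≡-Reasoning

sum-map-interval-single : ∀ s d p₀ (F : ℕ → ℕ) → s ≤ p₀ → p₀ < s + d → (∀ p → p ≢ p₀ → F p ≡ 0) →
  sum (map F (interval s d)) ≡ F p₀
sum-map-interval-single s zero p₀ F s≤p₀ p₀< _ =
  ⊥-elim (<-irrefl refl (≤-trans p₀< (≤-trans (≤-reflexive (+-identityʳ s)) s≤p₀)))
sum-map-interval-single s (suc d) p₀ F s≤p₀ p₀< F≡0 with s ≟ p₀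
... | yes refl = trans (cong (F s +_) (sum-map-≡0 F (All.map (λ s<p → F≡0 _ (>⇒≢ s<p)) (interval-≥ (suc s) d))))
                       (+-identityʳ _)
... | no s≢p₀ = trans (cong (_+ sum (map F (interval (suc s) d))) (F≡0 s s≢p₀))
                  (sum-map-interval-single (suc s) d p₀ F (≤∧≢⇒< s≤p₀ s≢p₀) (subst (p₀ <_) (+-suc s d) p₀<) F≡0)

compsB-isComposition : ∀ f m → All IsComposition (compsB f m)
compsB-isComposition f zero = [] ∷ []
compsB-isComposition zero (suc m) = []
compsB-isComposition (suc f) (suc m) = concat⁺ (map⁺ (applyUpTo⁺₂ id (suc m)
  (λ p → map⁺ (All.map (s≤s z≤n ∷_) (compsB-isComposition f (m ∸ p))))))

sum-compsB-single : ∀ f m (g : List ℕ → ℕ) γ → IsComposition γ → sum γ ≡ m → length γ ≤ f →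
  (∀ β → IsComposition β → β ≢ γ → g β ≡ 0) → sum (map g (compsB f m)) ≡ g γ
sum-compsB-single f zero g [] _ _ _ _ = +-identityʳ _
sum-compsB-single f zero g (zero ∷ γ) (() ∷ _) _ _ _
sum-compsB-single f zero g (suc p₀ ∷ γ) _ () _ _
sum-compsB-single f (suc m) g [] _ () _ _
sum-compsB-single zero (suc m) g (_ ∷ γ) _ _ () _
sum-compsB-single (suc f) (suc m) g (suc p₀ ∷ γ) (_ ∷ γ⁺) Σγ≡ (s≤s len≤) g≡0 = begin
  sum (map g (concatMap H (upTo (suc m))))    ≡⟨ sum-map-concatMap g H (upTo (suc m)) ⟩
  sum (map F (upTo (suc m)))                  ≡⟨ cong (sum ∘ map F) (upTo≡interval (suc m)) ⟩
  sum (map F (interval 0 (suc m)))            ≡⟨ sum-map-interval-single 0 (suc m) p₀ F z≤n (s≤s p₀≤m) F≡0 ⟩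
  F p₀                                        ≡⟨ sum-map-∘ p₀ ⟩
  sum (map (g ∘ (suc p₀ ∷_)) (compsB f (m ∸ p₀)))
    ≡⟨ sum-compsB-single f (m ∸ p₀) (g ∘ (suc p₀ ∷_)) γ γ⁺ Σγ≡m∸p₀ len≤
         (λ β β⁺ β≢γ → g≡0 (suc p₀ ∷ β) (s≤s z≤n ∷ β⁺) (β≢γ ∘ List.∷-injectiveʳ)) ⟩
  g (suc p₀ ∷ γ) ∎
  where
  open ≡-Reasoning
  H : ℕ → List (List ℕ)
  H p = map (suc p ∷_) (compsB f (m ∸ p))
  F : ℕ → ℕ
  F p = sum (map g (H p))
  sum-map-∘ : ∀ p → F p ≡ sum (map (g ∘ (suc p ∷_)) (compsB f (m ∸ p)))
  sum-map-∘ p = cong sum (sym (List.map-∘ (compsB f (m ∸ p))))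
  p₀+Σγ≡m : p₀ + sum γ ≡ m
  p₀+Σγ≡m = suc-injective Σγ≡
  p₀≤m : p₀ ≤ m
  p₀≤m = subst (p₀ ≤_) p₀+Σγ≡m (m≤m+n p₀ (sum γ))
  Σγ≡m∸p₀ : sum γ ≡ m ∸ p₀
  Σγ≡m∸p₀ = sym (trans (cong (_∸ p₀) (sym p₀+Σγ≡m)) (m+n∸m≡n p₀ (sum γ)))
  F≡0 : ∀ p → p ≢ p₀ → F p ≡ 0
  F≡0 p p≢p₀ = trans (sum-map-∘ p) (sum-map-≡0 _ (All.map
    (λ β⁺ → g≡0 _ (s≤s z≤n ∷ β⁺) (p≢p₀ ∘ suc-injective ∘ List.∷-injectiveˡ))
    (compsB-isComposition f (m ∸ p))))

length≤sum : ∀ γ → IsComposition γ → length γ ≤ sum γ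
length≤sum [] _ = z≤n
length≤sum (x ∷ γ) (x>0 ∷ γ⁺) = +-mono-≤ x>0 (length≤sum γ γ⁺)

refines-refl : ∀ α → refinesᵇ α α ≡ true
refines-refl [] = refl
refines-refl (a ∷ α) rewrite <ᵇ-irrefl a | ≡ᵇ-refl a = refines-refl α

refines⇒sum≡ : ∀ β α → refinesᵇ β α ≡ true → sum β ≡ sum α
refines⇒sum≡ [] [] _ = refl
refines⇒sum≡ (b ∷ β) (a ∷ α) e with b <ᵇ a in b<ᵇa
... | true = begin
  b + sum β                  ≡⟨ cong (b +_) (refines⇒sum≡ β ((a ∸ b) ∷ α) e) ⟩
  b + ((a ∸ b) + sum α)      ≡⟨ +-assoc b (a ∸ b) (sum α) ⟨
  (b + (a ∸ b)) + sum α      ≡⟨ cong (_+ sum α) (m+[n∸m]≡n (<⇒≤ (<ᵇ⇒< b a (Equivalence.from T-≡ b<ᵇa)))) ⟩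
  a + sum α                  ∎
  where open ≡-Reasoning
... | false with b ≡ᵇ a in b≡ᵇa
...   | true = cong₂ _+_ (≡ᵇ⇒≡ b a (Equivalence.from T-≡ b≡ᵇa)) (refines⇒sum≡ β α e)

-- With δ = length β ∸ length α: the first r blocks of α use at most δ + r parts of β.
refines⇒sum-take≤ : ∀ β α → refinesᵇ β α ≡ true →
  ∃[ δ ] length β ≡ δ + length α × (∀ r → r ≤ length α → sum (take r α) ≤ sum (take (δ + r) β))
refines⇒sum-take≤ [] [] _ = 0 , refl , λ { zero _ → z≤n }
refines⇒sum-take≤ (b ∷ β) (a ∷ α) e with b <ᵇ a in b<ᵇa
... | true with refines⇒sum-take≤ β ((a ∸ b) ∷ α) e
...   | δ , len≡ , take≤ = suc δ , cong suc len≡ , prefix≤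
  where
  prefix≤ : ∀ r → r ≤ suc (length α) → sum (take r (a ∷ α)) ≤ sum (take (suc δ + r) (b ∷ β))
  prefix≤ zero _ = z≤n
  prefix≤ (suc r) r≤ = begin
    a + sum (take r α)                   ≡⟨ cong (_+ sum (take r α)) (m+[n∸m]≡n (<⇒≤ (<ᵇ⇒< b a (Equivalence.from T-≡ b<ᵇa)))) ⟨
    (b + (a ∸ b)) + sum (take r α)       ≡⟨ +-assoc b (a ∸ b) _ ⟩
    b + sum (take (suc r) ((a ∸ b) ∷ α)) ≤⟨ +-monoʳ-≤ b (take≤ (suc r) r≤) ⟩
    b + sum (take (δ + suc r) β)         ∎
    where open ≤-Reasoning
refines⇒sum-take≤ (b ∷ β) (a ∷ α) e | false with b ≡ᵇ a in b≡ᵇa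
... | true with refines⇒sum-take≤ β α e
...   | δ , len≡ , take≤ = δ , trans (cong suc len≡) (sym (+-suc δ (length α))) , prefix≤
  where
  prefix≤ : ∀ r → r ≤ suc (length α) → sum (take r (a ∷ α)) ≤ sum (take (δ + r) (b ∷ β))
  prefix≤ zero _ = z≤n
  prefix≤ (suc r) (s≤s r≤) rewrite +-suc δ r | ≡ᵇ⇒≡ b a (Equivalence.from T-≡ b≡ᵇa) = +-monoʳ-≤ a (take≤ r r≤)

fundQS-char : ∀ {n} α k (b : Vec ℕ n) → k ≤ n →
  fundQS α k b ≡ 𝟙 (allZeroᵇ (drop k (toList b)) ∧ refinesᵇ (flatList (toList b)) α)
fundQS-char α k b k≤n with refinesᵇ (flatList (toList b)) α in γ≼α
... | true = begin
  sum (map g (compositions (sum α)))   ≡⟨ sum-compsB-single (sum α) (sum α) g γ γ⁺ Σγ≡Σα length≤Σα g≡0 ⟩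
  g γ                                  ≡⟨ cong (λ t → if t then monoQS γ k b else 0) γ≼α ⟩
  monoQS γ k b                         ≡⟨ monoQS-flat k b k≤n ⟩
  𝟙 (allZeroᵇ (drop k (toList b)))    ≡⟨ cong 𝟙 (∧-identityʳ _) ⟨
  𝟙 (allZeroᵇ (drop k (toList b)) ∧ true) ∎
  where
  open ≡-Reasoning
  γ = flatList (toList b)
  γ⁺ = flat-isComposition (toList b)
  g : List ℕ → ℕ
  g β = if refinesᵇ β α then monoQS β k b else 0
  g≡0 : ∀ β → IsComposition β → β ≢ γ → g β ≡ 0
  g≡0 β β⁺ β≢γ with refinesᵇ β α
  ... | true = monoQS-≢flat β k b β⁺ k≤n β≢γ
  ... | false = refl
  Σγ≡Σα = refines⇒sum≡ γ α γ≼α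
  length≤Σα = subst (length γ ≤_) Σγ≡Σα (length≤sum γ γ⁺)
... | false = trans (sum-map-≡0 g (All.map (g≡0 _) (compsB-isComposition (sum α) (sum α))))
                    (cong 𝟙 (sym (∧-zeroʳ _)))
  where
  γ = flatList (toList b)
  g : List ℕ → ℕ
  g β = if refinesᵇ β α then monoQS β k b else 0
  g≡0 : ∀ β → IsComposition β → g β ≡ 0
  g≡0 β β⁺ with List.≡-dec _≟_ β γ
  ... | yes refl rewrite γ≼α = refl
  ... | no β≢γ with refinesᵇ β α
  ...   | true = monoQS-≢flat β k b β⁺ k≤n β≢γ
  ...   | false = refl

-- Dominance

domAux-intro : ∀ {n} sb sa (b a : Vec ℕ n) →
  (∀ i → sa + sum (take i (toList a)) ≤ sb + sum (take i (toList b))) → domAux sb sa b a ≡ true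
domAux-intro sb sa Vec.[] Vec.[] _ = refl
domAux-intro sb sa (x Vec.∷ b) (y Vec.∷ a) prefix≤ = cong₂ _∧_ (Equivalence.to T-≡ (≤⇒≤ᵇ first≤))
  (domAux-intro (sb + x) (sa + y) b a
    (λ i → ≤-trans (≤-reflexive (+-assoc sa y _)) (≤-trans (prefix≤ (suc i)) (≤-reflexive (sym (+-assoc sb x _))))))
  where
  first≤ : sa + y ≤ sb + x
  first≤ = subst₂ (λ s t → sa + s ≤ sb + t) (+-identityʳ y) (+-identityʳ x) (prefix≤ 1)

domAux-elim : ∀ {n} sb sa (b a : Vec ℕ n) → sa ≤ sb → domAux sb sa b a ≡ true →
  ∀ i → sa + sum (take i (toList a)) ≤ sb + sum (take i (toList b))
domAux-elim sb sa Vec.[] Vec.[] sa≤sb _ zero = +-monoˡ-≤ 0 sa≤sb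
domAux-elim sb sa Vec.[] Vec.[] sa≤sb _ (suc i) = +-monoˡ-≤ 0 sa≤sb
domAux-elim sb sa (x Vec.∷ b) (y Vec.∷ a) sa≤sb _ zero = +-monoˡ-≤ 0 sa≤sb
domAux-elim sb sa (x Vec.∷ b) (y Vec.∷ a) _ e (suc i) with (sa + y) ≤ᵇ (sb + x) in first≤
... | true = begin
  sa + (y + sum (take i (toList a)))   ≡⟨ +-assoc sa y _ ⟨
  sa + y + sum (take i (toList a))     ≤⟨ domAux-elim (sb + x) (sa + y) b a (≤ᵇ⇒≤ (sa + y) (sb + x) (Equivalence.from T-≡ first≤)) e i ⟩
  sb + x + sum (take i (toList b))     ≡⟨ +-assoc sb x _ ⟩
  sb + (x + sum (take i (toList b)))   ∎
  where open ≤-Reasoning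

dominates⇔prefix-sums : ∀ {n} (b a : Vec ℕ n) →
  dominatesᵇ b a ≡ true ⇔ (∀ i → sum (take i (toList a)) ≤ sum (take i (toList b)))
dominates⇔prefix-sums b a = mk⇔ (domAux-elim 0 0 b a z≤n) (domAux-intro 0 0 b a)

module _ {n} (p : ℕ) (α : List ℕ) (q : ℕ) (a b : Vec ℕ n)
         (a≡ : toList a ≡ zeros p ++ α ++ zeros q)
         (b≼α : refinesᵇ (flatList (toList b)) α ≡ true) where

  private
    as = toList a
    bs = toList b
    β = flatList bs
    k = p + length α

    sum-take-a : ∀ r → sum (take (p + r) as) ≡ sum (take r (α ++ zeros q))
    sum-take-a r rewrite a≡ =
      trans (cong (λ t → sum (take (t + r) (zeros p ++ α ++ zeros q))) (sym (List.length-replicate p)))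
            (trans (sum-take-++ʳ (zeros p) r (α ++ zeros q)) (cong (_+ _) (sum-zeros p)))

    sum-a : sum as ≡ sum α
    sum-a rewrite a≡ = begin
      sum (zeros p ++ α ++ zeros q)        ≡⟨ sum-++ (zeros p) (α ++ zeros q) ⟩
      sum (zeros p) + sum (α ++ zeros q)   ≡⟨ cong (_+ sum (α ++ zeros q)) (sum-zeros p) ⟩
      sum (α ++ zeros q)                   ≡⟨ sum-++ α (zeros q) ⟩
      sum α + sum (zeros q)                ≡⟨ cong (sum α +_) (sum-zeros q) ⟩
      sum α + 0                            ≡⟨ +-identityʳ _ ⟩
      sum α                                ∎
      where open ≡-Reasoning

    sum-b : sum bs ≡ sum α
    sum-b = trans (sym (sum-flat bs)) (refines⇒sum≡ β α b≼α)

    sum-take-k-a : sum (take k as) ≡ sum α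
    sum-take-k-a = trans (sum-take-a (length α))
      (trans (sum-take-++ˡ (length α) α (zeros q) ≤-refl) (cong sum (List.take-all (length α) α ≤-refl)))

    dominates⇒tail-zero : dominatesᵇ b a ≡ true → allZeroᵇ (drop k bs) ≡ true
    dominates⇒tail-zero b≥a = sum≡0⇒allZero (drop k bs) (n≤0⇒n≡0 (+-cancelˡ-≤ (sum (take k bs)) _ _ (begin
      sum (take k bs) + sum (drop k bs)   ≡⟨ sum-take+sum-drop k bs ⟨
      sum bs                              ≡⟨ trans sum-b (sym sum-take-k-a) ⟩
      sum (take k as)                     ≤⟨ Equivalence.to (dominates⇔prefix-sums b a) b≥a k ⟩
      sum (take k bs)                     ≡⟨ +-identityʳ _ ⟨
      sum (take k bs) + 0                 ∎)))
      where open ≤-Reasoning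

    prefix-inside : allZeroᵇ (drop k bs) ≡ true →
      ∀ r → r ≤ length α → sum (take (p + r) as) ≤ sum (take (p + r) bs)
    prefix-inside tail0 r r≤ with refines⇒sum-take≤ β α b≼α
    ... | δ , length-β≡ , take≤ = begin
      sum (take (p + r) as)   ≡⟨ trans (sum-take-a r) (sum-take-++ˡ r α (zeros q) r≤) ⟩
      sum (take r α)          ≤⟨ take≤ r r≤ ⟩
      sum (take (δ + r) β)    ≤⟨ sum-take-mono (δ + r) j β δ+r≤j ⟩
      sum (take j β)          ≡⟨ sum-take-flat i bs ⟨
      sum (take i bs)         ∎
      where
      open ≤-Reasoning
      i = p + r
      u = length α ∸ r
      r+u≡ : r + u ≡ length α
      r+u≡ = m+[n∸m]≡n r≤
      j = length (flatList (take i bs))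
      rest≤u : length (flatList (drop i bs)) ≤ u
      rest≤u = length-flat-allZero-drop u (drop i bs)
        (subst (λ t → allZeroᵇ t ≡ true)
               (sym (trans (List.drop-drop i u bs) (cong (λ t → drop t bs) (trans (+-assoc p r u) (cong (p +_) r+u≡)))))
               tail0)
      δ+r≤j : δ + r ≤ j
      δ+r≤j = +-cancelʳ-≤ u (δ + r) j (begin
        δ + r + u                                       ≡⟨ trans (+-assoc δ r u) (cong (δ +_) r+u≡) ⟩
        δ + length α                                    ≡⟨ length-β≡ ⟨
        length β                                        ≡⟨ length-flat-split i bs ⟩
        j + length (flatList (drop i bs))               ≤⟨ +-monoʳ-≤ j rest≤u ⟩
        j + u                                           ∎)

    prefix-after : allZeroᵇ (drop k bs) ≡ true → ∀ i → k ≤ i → sum (take i as) ≤ sum (take i bs)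
    prefix-after tail0 i k≤i = begin
      sum (take i as)                     ≤⟨ sum-take≤sum i as ⟩
      sum as                              ≡⟨ trans sum-a (sym sum-b) ⟩
      sum bs                              ≡⟨ sum-take+sum-drop i bs ⟩
      sum (take i bs) + sum (drop i bs)   ≡⟨ cong (sum (take i bs) +_) (allZero⇒sum≡0 (drop i bs) tail0ᵢ) ⟩
      sum (take i bs) + 0                 ≡⟨ +-identityʳ _ ⟩
      sum (take i bs)                     ∎
      where
      open ≤-Reasoning
      tail0ᵢ : allZeroᵇ (drop i bs) ≡ true
      tail0ᵢ = subst (λ t → allZeroᵇ t ≡ true)
        (trans (List.drop-drop k (i ∸ k) bs) (cong (λ t → drop t bs) (m+[n∸m]≡n k≤i)))
        (allZero-drop (i ∸ k) (drop k bs) tail0)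

    tail-zero⇒prefix-sums : allZeroᵇ (drop k bs) ≡ true → ∀ i → sum (take i as) ≤ sum (take i bs)
    tail-zero⇒prefix-sums tail0 i with i ≤? p
    ... | yes i≤p = ≤-trans (sum-take-mono i (p + 0) as (≤-trans i≤p (m≤m+n p 0))) (≤-trans (≤-reflexive (sum-take-a 0)) z≤n)
    ... | no i≰p with i ∸ p ≤? length α
    ...   | yes i∸p≤ = subst (λ t → sum (take t as) ≤ sum (take t bs)) (m+[n∸m]≡n p≤i) (prefix-inside tail0 (i ∸ p) i∸p≤)
      where p≤i = <⇒≤ (≰⇒> i≰p)
    ...   | no i∸p≰ = prefix-after tail0 i (subst (k ≤_) (m+[n∸m]≡n p≤i) (+-monoʳ-≤ p (<⇒≤ (≰⇒> i∸p≰))))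
      where p≤i = <⇒≤ (≰⇒> i≰p)

  dominates⇔tail-zero : dominatesᵇ b a ≡ true ⇔ allZeroᵇ (drop (p + length α) (toList b)) ≡ true
  dominates⇔tail-zero = mk⇔ dominates⇒tail-zero (Equivalence.from (dominates⇔prefix-sums b a) ∘ tail-zero⇒prefix-sums)

-- Quasi-flat weak compositions

lastNZ-step : ℕ → ℕ → ℕ
lastNZ-step x zero = if x ≡ᵇ 0 then 0 else 1
lastNZ-step x (suc m) = suc (suc m)

lastNZList-∷ : ∀ x xs → lastNZList (x ∷ xs) ≡ lastNZ-step x (lastNZList xs)
lastNZList-∷ x xs with lastNZList xs
... | zero = refl
... | suc m = refl

lastNZList-zeros : ∀ p → lastNZList (zeros p) ≡ 0
lastNZList-zeros zero = refl
lastNZList-zeros (suc p) = trans (lastNZList-∷ 0 (zeros p)) (cong (lastNZ-step 0) (lastNZList-zeros p))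

lastNZList-++-zeros : ∀ xs q → lastNZList (xs ++ zeros q) ≡ lastNZList xs
lastNZList-++-zeros [] q = lastNZList-zeros q
lastNZList-++-zeros (x ∷ xs) q = begin
  lastNZList (x ∷ xs ++ zeros q)             ≡⟨ lastNZList-∷ x (xs ++ zeros q) ⟩
  lastNZ-step x (lastNZList (xs ++ zeros q)) ≡⟨ cong (lastNZ-step x) (lastNZList-++-zeros xs q) ⟩
  lastNZ-step x (lastNZList xs)              ≡⟨ lastNZList-∷ x xs ⟨
  lastNZList (x ∷ xs)                        ∎
  where open ≡-Reasoning

lastNZList-composition : ∀ x α → IsComposition α → lastNZList (suc x ∷ α) ≡ suc (length α)
lastNZList-composition x [] _ = refl
lastNZList-composition x (suc y ∷ α) (_ ∷ α⁺) =
  trans (lastNZList-∷ (suc x) (suc y ∷ α)) (cong (lastNZ-step (suc x)) (lastNZList-composition y α α⁺))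

lastNZList-zeros-++ : ∀ p ys m → lastNZList ys ≡ suc m → lastNZList (zeros p ++ ys) ≡ suc (p + m)
lastNZList-zeros-++ zero ys m e = e
lastNZList-zeros-++ (suc p) ys m e =
  trans (lastNZList-∷ 0 (zeros p ++ ys)) (cong (lastNZ-step 0) (lastNZList-zeros-++ p ys m e))

lastNZList-padded : ∀ p x α q → IsComposition α →
  lastNZList (zeros p ++ (suc x ∷ α) ++ zeros q) ≡ p + length (suc x ∷ α)
lastNZList-padded p x α q α⁺ = begin
  lastNZList (zeros p ++ (suc x ∷ α) ++ zeros q) ≡⟨ lastNZList-zeros-++ p _ (length α) (trans (lastNZList-++-zeros (suc x ∷ α) q)
                                                                                               (lastNZList-composition x α α⁺)) ⟩
  suc (p + length α)                             ≡⟨ +-suc p (length α) ⟨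
  p + length (suc x ∷ α)                         ∎
  where open ≡-Reasoning

allZero-drop-lastNZList : ∀ xs → allZeroᵇ (drop (lastNZList xs) xs) ≡ true
allZero-drop-lastNZList [] = refl
allZero-drop-lastNZList (x ∷ xs) rewrite lastNZList-∷ x xs with lastNZList xs | allZero-drop-lastNZList xs
... | zero | tail0 with x
...   | zero = tail0
...   | suc _ = tail0
allZero-drop-lastNZList (x ∷ xs) | suc m | tail0 = tail0

lastNZList≤length : ∀ xs → lastNZList xs ≤ length xs
lastNZList≤length [] = z≤n
lastNZList≤length (x ∷ xs) rewrite lastNZList-∷ x xs with lastNZList xs | lastNZList≤length xs
... | zero | _ with x
...   | zero = z≤n
...   | suc _ = s≤s z≤n
lastNZList≤length (x ∷ xs) | suc m | m<len = s≤s m<len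

QuasiFlatList : List ℕ → Set
QuasiFlatList xs = ∀ i j l → i ≤ j → j ≤ l → nth xs i ≢ 0 → nth xs l ≢ 0 → nth xs j ≢ 0

quasiFlat⇔quasiFlatList : ∀ {n} (a : Vec ℕ n) → QuasiFlat a ⇔ QuasiFlatList (toList a)
quasiFlat⇔quasiFlatList {n} a = mk⇔ to from
  where
  as = toList a
  lookup≡nth : ∀ t (t<n : t < n) → Vec.lookup a (fromℕ< t<n) ≡ nth as t
  lookup≡nth t t<n = trans (nth-toList a (fromℕ< t<n)) (cong (nth as) (toℕ-fromℕ< t<n))
  to : QuasiFlat a → QuasiFlatList as
  to qf i j l i≤j j≤l ai≢0 al≢0 =
    subst (_≢ 0) (lookup≡nth j j<n)
      (qf (fromℕ< i<n) (fromℕ< j<n) (fromℕ< l<n)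
          (subst₂ _≤_ (sym (toℕ-fromℕ< i<n)) (sym (toℕ-fromℕ< j<n)) i≤j)
          (subst₂ _≤_ (sym (toℕ-fromℕ< j<n)) (sym (toℕ-fromℕ< l<n)) j≤l)
          (subst (_≢ 0) (sym (lookup≡nth i i<n)) ai≢0)
          (subst (_≢ 0) (sym (lookup≡nth l l<n)) al≢0))
    where
    l<n = subst (l <_) (Vec.length-toList a) (nth≢0⇒<length as l al≢0)
    j<n = ≤-<-trans j≤l l<n
    i<n = ≤-<-trans i≤j j<n
  from : QuasiFlatList as → QuasiFlat a
  from qf i j l i≤j j≤l ai≢0 al≢0 =
    subst (_≢ 0) (sym (nth-toList a j))
      (qf (toℕ i) (toℕ j) (toℕ l) i≤j j≤l (subst (_≢ 0) (nth-toList a i) ai≢0) (subst (_≢ 0) (nth-toList a l) al≢0))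

span-zeros : ∀ xs → ∃[ p ] ∃[ r ] xs ≡ zeros p ++ r × (r ≡ [] ⊎ ∃[ y ] ∃[ r′ ] r ≡ suc y ∷ r′)
span-zeros [] = 0 , [] , refl , inj₁ refl
span-zeros (zero ∷ xs) with span-zeros xs
... | p , r , xs≡ , r-shape = suc p , r , cong (0 ∷_) xs≡ , r-shape
span-zeros (suc y ∷ xs) = 0 , suc y ∷ xs , refl , inj₂ (y , xs , refl)

span-positive : ∀ r → ∃[ α ] ∃[ t ] r ≡ α ++ t × IsComposition α × nth t 0 ≡ 0
span-positive [] = [] , [] , refl , [] , refl
span-positive (zero ∷ r) = [] , 0 ∷ r , refl , [] , refl
span-positive (suc y ∷ r) with span-positive r
... | α , t , r≡ , α⁺ , t₀≡0 = suc y ∷ α , t , cong (suc y ∷_) r≡ , s≤s z≤n ∷ α⁺ , t₀≡0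

quasiFlat-shape : ∀ xs → QuasiFlatList xs →
  ∃[ p ] ∃[ α ] ∃[ q ] xs ≡ zeros p ++ α ++ zeros q × IsComposition α × lastNZList xs ≡ p + length α
quasiFlat-shape xs qf with span-zeros xs
... | p , r , xs≡ , inj₁ refl =
  0 , [] , p , xs≡′ , [] , trans (cong lastNZList xs≡′) (lastNZList-zeros p)
  where xs≡′ = trans xs≡ (List.++-identityʳ (zeros p))
... | p , .(suc y ∷ r′) , xs≡ , inj₂ (y , r′ , refl) with span-positive r′
...   | α₀ , t , r′≡ , α₀⁺ , t₀≡0 with allZeroᵇ t in t-zero
...     | true = p , α , length t , xs≡′ , s≤s z≤n ∷ α₀⁺ ,
                 trans (cong lastNZList xs≡′) (lastNZList-padded p y α₀ (length t) α₀⁺)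
  where
  α = suc y ∷ α₀
  xs≡′ : xs ≡ zeros p ++ α ++ zeros (length t)
  xs≡′ = trans xs≡ (cong (λ z → zeros p ++ suc y ∷ z) (trans r′≡ (cong (α₀ ++_) (allZero⇒≡zeros t t-zero))))
...     | false with allZero-false⇒nth≢0 t t-zero
...       | u , tᵤ≢0 = ⊥-elim (qf p (p + (length α + 0)) (p + (length α + u))
              (m≤m+n p _) (+-monoʳ-≤ p (+-monoʳ-≤ (length α) z≤n))
              (λ head≡0 → 0≢1+n (sym (trans (sym (nth-xs-head)) head≡0)))
              (λ xsₗ≡0 → tᵤ≢0 (trans (sym (nth-xs-tail u)) xsₗ≡0))
              (trans (nth-xs-tail 0) t₀≡0))
  where
  α = suc y ∷ α₀
  xs≡′ : xs ≡ zeros p ++ α ++ t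
  xs≡′ = trans xs≡ (cong (λ z → zeros p ++ suc y ∷ z) r′≡)
  nth-xs-head : nth xs p ≡ suc y
  nth-xs-head = trans (cong (λ z → nth z p) xs≡′) (trans (cong (nth (zeros p ++ α ++ t)) (sym (+-identityʳ p)))
                  (nth-zeros-++ p (α ++ t) 0))
  nth-xs-tail : ∀ s → nth xs (p + (length α + s)) ≡ nth t s
  nth-xs-tail s = trans (cong (λ z → nth z (p + (length α + s))) xs≡′)
                    (trans (nth-zeros-++ p (α ++ t) (length α + s)) (nth-++ α t s))

allZero-take⇒nth≡0 : ∀ d xs t → allZeroᵇ (take d xs) ≡ true → t < d → nth xs t ≡ 0
allZero-take⇒nth≡0 d xs t z t<d = trans (sym (nth-take d xs t t<d)) (allZero-nth (take d xs) t z)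

allZero-drop⇒nth≡0 : ∀ d xs t → allZeroᵇ (drop d xs) ≡ true → d ≤ t → nth xs t ≡ 0
allZero-drop⇒nth≡0 d xs t z d≤t = begin
  nth xs t                ≡⟨ cong (nth xs) (m+[n∸m]≡n d≤t) ⟨
  nth xs (d + (t ∸ d))    ≡⟨ nth-drop d xs (t ∸ d) ⟨
  nth (drop d xs) (t ∸ d) ≡⟨ allZero-nth (drop d xs) (t ∸ d) z ⟩
  0                       ∎
  where open ≡-Reasoning

window⇒quasiFlat : ∀ i₀ ℓ xs → i₀ + ℓ ≤ length xs →
  allZeroᵇ (take i₀ xs) ≡ true → allZeroᵇ (drop (i₀ + ℓ) xs) ≡ true → length (flatList xs) ≡ ℓ →
  QuasiFlatList xs
window⇒quasiFlat i₀ ℓ xs i₀+ℓ≤ head0 tail0 #nonzero≡ℓ i j l i≤j j≤l xᵢ≢0 xₗ≢0 xⱼ≡0 =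
  <-irrefl (trans (sym #nonzero≡#w) #nonzero≡ℓ) #w<ℓ
  where
  i₀≤j : i₀ ≤ j
  i₀≤j = ≤-trans (≮⇒≥ (xᵢ≢0 ∘ allZero-take⇒nth≡0 i₀ xs i head0)) i≤j
  j<i₀+ℓ : j < i₀ + ℓ
  j<i₀+ℓ = ≤-<-trans j≤l (≰⇒> (xₗ≢0 ∘ allZero-drop⇒nth≡0 (i₀ + ℓ) xs l tail0))
  w = take ℓ (drop i₀ xs)
  length-w : length w ≡ ℓ
  length-w = trans (List.length-take ℓ (drop i₀ xs))
    (m≤n⇒m⊓n≡m (subst (ℓ ≤_) (sym (List.length-drop i₀ xs)) (subst (_≤ length xs ∸ i₀) (m+n∸m≡n i₀ ℓ) (∸-monoˡ-≤ i₀ i₀+ℓ≤))))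
  t<ℓ : j ∸ i₀ < ℓ
  t<ℓ = subst (j ∸ i₀ <_) (m+n∸m≡n i₀ ℓ) (∸-monoˡ-< j<i₀+ℓ i₀≤j)
  wₜ≡0 : nth w (j ∸ i₀) ≡ 0
  wₜ≡0 = trans (nth-take ℓ (drop i₀ xs) (j ∸ i₀) t<ℓ)
           (trans (nth-drop i₀ xs (j ∸ i₀)) (trans (cong (nth xs) (m+[n∸m]≡n i₀≤j)) xⱼ≡0))
  #w<ℓ : length (flatList w) < ℓ
  #w<ℓ = subst (length (flatList w) <_) length-w
           (length-flat< w (j ∸ i₀) (subst (j ∸ i₀ <_) (sym length-w) t<ℓ) wₜ≡0)
  #nonzero≡#w : length (flatList xs) ≡ length (flatList w)
  #nonzero≡#w = begin
    length (flatList xs)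
      ≡⟨ length-flat-split i₀ xs ⟩
    length (flatList (take i₀ xs)) + length (flatList (drop i₀ xs))
      ≡⟨ cong₂ (λ s t → length s + t) (allZero⇒flat≡[] (take i₀ xs) head0) (length-flat-split ℓ (drop i₀ xs)) ⟩
    length (flatList w) + length (flatList (drop ℓ (drop i₀ xs)))
      ≡⟨ cong (λ s → length (flatList w) + length (flatList s)) (List.drop-drop i₀ ℓ xs) ⟩
    length (flatList w) + length (flatList (drop (i₀ + ℓ) xs))
      ≡⟨ cong (λ s → length (flatList w) + length s) (allZero⇒flat≡[] (drop (i₀ + ℓ) xs) tail0) ⟩
    length (flatList w) + 0
      ≡⟨ +-identityʳ _ ⟩
    length (flatList w) ∎
    where open ≡-Reasoning

∧-congʳ-⇔ : ∀ {x x′} y → (y ≡ true → (x ≡ true ⇔ x′ ≡ true)) → x ∧ y ≡ x′ ∧ y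
∧-congʳ-⇔ false _ = trans (∧-zeroʳ _) (sym (∧-zeroʳ _))
∧-congʳ-⇔ true x⇔x′ = trans (∧-identityʳ _) (trans (⇔→≡ (x⇔x′ refl)) (sym (∧-identityʳ _)))

𝟙-∧≡1⇒ˡ : ∀ x {y} → 𝟙 (x ∧ y) ≡ 1 → x ≡ true
𝟙-∧≡1⇒ˡ true _ = refl

flat-padded : ∀ p α q → IsComposition α → flatList (zeros p ++ α ++ zeros q) ≡ α
flat-padded p α q α⁺ = begin
  flatList (zeros p ++ α ++ zeros q)                   ≡⟨ flat-++ (zeros p) (α ++ zeros q) ⟩
  flatList (zeros p) ++ flatList (α ++ zeros q)        ≡⟨ cong (_++ flatList (α ++ zeros q)) (flat-zeros p) ⟩
  flatList (α ++ zeros q)                              ≡⟨ flat-++ α (zeros q) ⟩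
  flatList α ++ flatList (zeros q)                     ≡⟨ cong₂ _++_ (flat-composition α α⁺) (flat-zeros q) ⟩
  α ++ []                                              ≡⟨ List.++-identityʳ α ⟩
  α                                                    ∎
  where open ≡-Reasoning

module _ {n} (a : Vec ℕ n) where

  lastNZ≤length : lastNZ a ≤ n
  lastNZ≤length = subst (lastNZ a ≤_) (Vec.length-toList a) (lastNZList≤length (toList a))

  private
    as = toList a
    k = lastNZ a
    α = flat a
    ℓ = length α

    tail0 : allZeroᵇ (drop k as) ≡ true
    tail0 = allZero-drop-lastNZList as

  slide-quasiFlat : QuasiFlat a → ∀ b →
    slide a b ≡ 𝟙 (allZeroᵇ (drop (lastNZ a) (toList b)) ∧ refinesᵇ (flatList (toList b)) (flat a))
  slide-quasiFlat qf b with quasiFlat-shape as (Equivalence.to (quasiFlat⇔quasiFlatList a) qf)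
  ... | p , α′ , q , a≡ , α′⁺ , k≡ = cong 𝟙 (∧-congʳ-⇔ _ (λ b≼α →
    subst (λ d → dominatesᵇ b a ≡ true ⇔ allZeroᵇ (drop d (toList b)) ≡ true) (sym k≡)
      (dominates⇔tail-zero p α′ q a b a≡ (subst (λ γ → refinesᵇ (flatList (toList b)) γ ≡ true) α≡α′ b≼α))))
    where
    α≡α′ : α ≡ α′
    α≡α′ = trans (cong flatList a≡) (flat-padded p α′ q α′⁺)

  quasiFlat⇒quasiSymmetric : QuasiFlat a → QuasiSymmetric (slide a) (lastNZ a)
  quasiFlat⇒quasiSymmetric qf α₁ α₁⁺ is js is-inc js-inc = trans (coefficient is is-inc) (sym (coefficient js js-inc))
    where
    coefficient : ∀ is → IncSeq (length α₁) k is → slide a (place is α₁) ≡ 𝟙 (true ∧ refinesᵇ α₁ α)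
    coefficient is (length-is , is-Linked , is<k) = trans (slide-quasiFlat qf (place is α₁))
      (cong 𝟙 (cong₂ (λ s t → s ∧ refinesᵇ t α) tail-zero flat-place))
      where
      tail-zero : allZeroᵇ (drop k (toList (place {n} is α₁))) ≡ true
      tail-zero = begin
        allZeroᵇ (drop k (toList (place {n} is α₁)))  ≡⟨ cong (allZeroᵇ ∘ drop k) (toList-place is α₁) ⟩
        allZeroᵇ (drop k (spread 0 n is α₁))          ≡⟨ cong allZeroᵇ (drop-spread k 0 n is α₁) ⟩
        allZeroᵇ (spread k (n ∸ k) is α₁)             ≡⟨ spread-allZero k (n ∸ k) is α₁ is<k ⟩
        true                                          ∎
        where open ≡-Reasoning
      flat-place : flatList (toList (place {n} is α₁)) ≡ α₁
      flat-place = trans (cong flatList (toList-place {n} is α₁))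
        (flat-spread 0 n is α₁ is-Linked (All.map (λ _ → z≤n) is<k) (All.map (λ i<k → <-≤-trans i<k lastNZ≤length) is<k) length-is α₁⁺)

  quasiSymmetric⇒quasiFlat : QuasiSymmetric (slide a) (lastNZ a) → QuasiFlat a
  quasiSymmetric⇒quasiFlat qs = Equivalence.from (quasiFlat⇔quasiFlatList a)
    (window⇒quasiFlat i₀ ℓ as (≤-trans (≤-reflexive i₀+ℓ≡k) (lastNZList≤length as)) head0
      (subst (λ d → allZeroᵇ (drop d as) ≡ true) (sym i₀+ℓ≡k) tail0) refl)
    where
    ℓ≤k : ℓ ≤ k
    ℓ≤k = length-flat-allZero-drop k as tail0
    i₀ = k ∸ ℓ
    i₀+ℓ≡k : i₀ + ℓ ≡ k
    i₀+ℓ≡k = m∸n+n≡m ℓ≤k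
    is = positions 0 as
    js = interval i₀ ℓ
    a≡place : place is α ≡ a
    a≡place = toList-injective _ a (trans (toList-place is α)
      (trans (cong (λ N → spread 0 N is α) (sym (Vec.length-toList a))) (spread-positions 0 as)))
    slide-a-a : slide a a ≡ 1
    slide-a-a = cong 𝟙 (cong₂ _∧_ (Equivalence.from (dominates⇔prefix-sums a a) (λ _ → ≤-refl)) (refines-refl α))
    shifted = place {n} js α
    slide-a-shifted : slide a shifted ≡ 1
    slide-a-shifted = trans (sym (qs α (flat-isComposition as) is js
      (length-positions 0 as , positions-Linked 0 as , positions-< 0 k as tail0)
      (length-interval i₀ ℓ , interval-Linked i₀ ℓ , All-<-cast i₀+ℓ≡k (interval-< i₀ ℓ))))
      (trans (cong (slide a) a≡place) slide-a-a)
    head0 : allZeroᵇ (take i₀ as) ≡ true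
    head0 = sum≡0⇒allZero (take i₀ as) (n≤0⇒n≡0 (begin
      sum (take i₀ as)                       ≤⟨ Equivalence.to (dominates⇔prefix-sums shifted a) (𝟙-∧≡1⇒ˡ _ slide-a-shifted) i₀ ⟩
      sum (take i₀ (toList shifted))         ≡⟨ cong (sum ∘ take i₀) (toList-place js α) ⟩
      sum (take i₀ (spread 0 n js α))        ≡⟨ sum-take-spread i₀ 0 n js α (interval-≥ i₀ ℓ) ⟩
      0                                      ∎))
      where open ≤-Reasoning

lemma3p8 : (n : ℕ) (a : WeakComp n) →
    (QuasiSymmetric (slide a) (lastNZ a) ⇔ QuasiFlat a) ×
    (QuasiFlat a → (b : Vec ℕ n) → slide a b ≡ fundQS (flat a) (lastNZ a) b)
lemma3p8 n a = mk⇔ (quasiSymmetric⇒quasiFlat a) (quasiFlat⇒quasiSymmetric a) ,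
  λ qf b → trans (slide-quasiFlat a qf b) (sym (fundQS-char (flat a) (lastNZ a) b (lastNZ≤length a)))
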